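{- Let $a,b,n$ be positive integers with $a+b\le n$. For a non-empty set $P\subset[n]$ with $|P|\le a$, let $Q$ be the partner of $P$. Then $\mathcal{L}([n],Q,b)$ is the maximum L-initial $b$-uniform family that is cross-intersecting to $\mathcal{L}([n],P,a)$. Moreover, $\mathcal{L}([n],Q,b)\ne\emptyset$ if and only if $\min P\le b$.
   Context: Lexicographic order on finite subsets of positive integers: $A\prec B$ if either $A\supseteq B$ or $\min(A\setminus B)<\min(B\setminus A)$ (so $A\prec A$). For a set $R$, $\mathcal{L}([n],R,k)=\{F\in\binom{[n]}{k}:F\prec R\}$. A family $\mathcal{F}\subset\binom{[n]}{k}$ is L-initial if it consists of the first $|\mathcal{F}|$ sets of $\binom{[n]}{k}$ in this order. Two families are cross-intersecting if every member of one meets every member of the other. Sets $A,B$ strongly intersect at their last element $q$ if $A\cap B=\{q\}$ and $A\cup B=[q]$; then $B$ is called $A$'s partner (and vice versa). -}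

module Defs where

open import Data.Nat using (ℕ; suc; _≤ᵇ_)
open import Data.Fin using (Fin; toℕ; _≤_; _<_)
open import Data.Fin.Subset using (Subset; _∈_; _∉_; _⊆_; _∩_; _∪_; ⁅_⁆; ∣_∣; Nonempty)
open import Data.Vec using (tabulate)
open import Data.Product using (Σ; _×_)
open import Data.Sum using (_⊎_)
open import Relation.Binary.PropositionalEquality using (_≡_)

-- Convention: a subset of [n] = {1,…,n} is a 'Subset n'; the index i : Fin n
-- stands for the positive integer toℕ i + 1 (order is preserved).

upTo : ∀ {n} → Fin n → Subset n
upTo q = tabulate (λ j → toℕ j ≤ᵇ toℕ q)

IsMin : ∀ {n} → Subset n → Fin n → Set
IsMin S i = i ∈ S × (∀ j → j ∈ S → i ≤ j)

_≺_ : ∀ {n} → Subset n → Subset n → Set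
_≺_ {n} A B =
  B ⊆ A
  ⊎ Σ (Fin n) (λ i →
      (i ∈ A × i ∉ B × (∀ j → j ∈ A → j ∉ B → i ≤ j))
      × (∀ j → j ∈ B → j ∉ A → i < j))

StronglyIntersectAt : ∀ {n} → Subset n → Subset n → Fin n → Set
StronglyIntersectAt A B q = (A ∩ B ≡ ⁅ q ⁆) × (A ∪ B ≡ upTo q)

-- B is A's partner: they strongly intersect at their last element q
-- (q is then automatically the maximum of both A and B).
Partner : ∀ {n} → Subset n → Subset n → Set
Partner {n} A B = Σ (Fin n) (λ q → StronglyIntersectAt A B q)

Family : ℕ → Set₁
Family n = Subset n → Set

𝓛 : (n : ℕ) → Subset n → ℕ → Family n
𝓛 n R k F = (∣ F ∣ ≡ k) × (F ≺ R)

-- 𝓕 ⊂ ([n] choose k) is L-initial: it consists of the first |𝓕| k-sets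
-- in the (total, on k-sets) order ≺, i.e. it is downward closed among k-sets.
LInitial : (n k : ℕ) → Family n → Set
LInitial n k 𝓕 =
  (∀ F → 𝓕 F → ∣ F ∣ ≡ k)
  × (∀ A B → ∣ A ∣ ≡ k → A ≺ B → 𝓕 B → 𝓕 A)

CrossIntersecting : ∀ {n} → Family n → Family n → Set
CrossIntersecting 𝓐 𝓑 = ∀ A B → 𝓐 A → 𝓑 B → Nonempty (A ∩ B)

module Submission where

-- A set precedes R lexicographically iff it equals R or contains the first point where the two differ.
-- Partners P and Q cover [q] and share only q, so for F ≺ Q and G ≺ P the earlier of the two first
-- differences from Q and P (if some lies in [q]) is a point of both F and G, and otherwise q is.
-- For maximality, suppose a b-set G meeting every member of 𝓛([n], P, a) first differs from Q at a
-- point i ∈ Q ∖ G. The points of P below i avoid Q, hence avoid G, so together with i they form a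
-- set of size at most |P| ≤ a inside the complement of G; as |∁ G| = n - b ≥ a it extends to an a-set
-- that still precedes P yet misses G. Finally Q contains every integer below min P, so any b-set
-- preceding Q strictly contains [1, min P), while [1, b] precedes Q as soon as min P ≤ b.

open import Defs
open import Data.Nat using (ℕ; zero; suc; _+_; _∸_; _≤_; _<_; z≤n; s≤s; _≤?_; _<?_)
import Data.Nat.Properties as ℕ
open import Data.Bool using (Bool)
open import Data.Bool.Properties using (T-≡)
open import Data.Empty using (⊥-elim)
open import Data.Fin as Fin using (Fin; zero; suc; toℕ)
open import Data.Fin.Properties using (<-cmp; toℕ<n)
open import Data.Fin.Subset
  using (Subset; inside; outside; ⊥; ⁅_⁆; ∁; _∩_; _∪_; _∈_; _∉_; _⊆_; _⊂_; ∣_∣; Nonempty)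
open import Data.Fin.Subset.Properties
  using (_∈?_; ∉⊥; ∣⊥∣≡0; drop-there; drop-∷-⊆; in⊆in; out⊆; s⊆s; ∣p∣≤∣x∷p∣; p⊆q⇒∣p∣≤∣q∣;
         p⊂q⇒∣p∣<∣q∣; x∈⁅x⁆; x∈⁅y⁆⇒x≡y; ∣⁅x⁆∣≡1; x∈p∩q⁺; x∈p∩q⁻; p∩q⊆p; x∈p∪q⁺; x∈p∪q⁻;
         x∉p⇒x∈∁p; x∈∁p⇒x∉p; ∣∁p∣≡n∸∣p∣)
open import Data.Product using (_×_; ∃; _,_; proj₁; proj₂)
import Data.Product as Prod
open import Data.Sum using (_⊎_; inj₁; inj₂; [_,_])
import Data.Sum as Sum
open import Data.Vec using ([]; _∷_; here; there)
open import Data.Vec.Properties using (lookup∘tabulate; lookup⇒[]=; []=⇒lookup)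
open import Function using (id; _∘_)
open import Function.Bundles using (Equivalence; _⇔_; mk⇔)
import Function.Properties.Equivalence as ⇔
open import Relation.Binary using (tri<; tri≈; tri>)
open import Relation.Binary.PropositionalEquality using (_≡_; refl; sym; trans; cong; subst; subst₂)
open import Relation.Nullary using (¬_; yes; no)

open Equivalence using (to; from)

private
  variable
    n k : ℕ
    i j q : Fin n
    s : Bool
    A B C : Subset n


∈upTo⁺ : toℕ j ≤ toℕ q → j ∈ upTo q
∈upTo⁺ {j = j} {q = q} j≤q =
  lookup⇒[]= j (upTo q) (trans (lookup∘tabulate _ j) (to T-≡ (ℕ.≤⇒≤ᵇ j≤q)))

∈upTo⁻ : j ∈ upTo q → toℕ j ≤ toℕ q
∈upTo⁻ {j = j} {q = q} j∈ =
  ℕ.≤ᵇ⇒≤ (toℕ j) (toℕ q) (from T-≡ (trans (sym (lookup∘tabulate _ j)) ([]=⇒lookup j∈)))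

initial : ℕ → Subset n
initial {zero} _ = []
initial {suc n} zero = ⊥
initial {suc n} (suc k) = inside ∷ initial k

∈initial⁺ : toℕ j < k → j ∈ initial k
∈initial⁺ {j = zero} {suc k} _ = here
∈initial⁺ {j = suc j} {suc k} (s≤s j<k) = there (∈initial⁺ j<k)

∈initial⁻ : ∀ {n k} {j : Fin n} → j ∈ initial k → toℕ j < k
∈initial⁻ {n = suc _} {k = zero} j∈ = ⊥-elim (∉⊥ j∈)
∈initial⁻ {k = suc k} here = s≤s z≤n
∈initial⁻ {k = suc k} (there j∈) = s≤s (∈initial⁻ j∈)

∣initial∣ : k ≤ n → ∣ initial {n} k ∣ ≡ k
∣initial∣ {zero} {zero} _ = refl
∣initial∣ {zero} {suc n} _ = ∣⊥∣≡0 (suc n)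
∣initial∣ {suc k} {suc n} (s≤s k≤n) = cong suc (∣initial∣ k≤n)


Agree : Subset n → Subset n → Fin n → Set
Agree A B i = ∀ {j} → j Fin.< i → (j ∈ A ⇔ j ∈ B)

FirstDiff : Subset n → Subset n → Fin n → Set
FirstDiff A B i = Agree A B i × i ∈ A × i ∉ B

_⊑_ : Subset n → Subset n → Set
A ⊑ B = A ≡ B ⊎ ∃ (FirstDiff A B)

agree-∷ : Agree A B i → Agree (s ∷ A) (s ∷ B) (suc i)
agree-∷ ag {zero} _ = mk⇔ (λ { here → here }) (λ { here → here })
agree-∷ ag {suc j} (s≤s j<i) =
  mk⇔ (there ∘ to (ag j<i) ∘ drop-there) (there ∘ from (ag j<i) ∘ drop-there)

firstDiff-∷ : FirstDiff A B i → FirstDiff (s ∷ A) (s ∷ B) (suc i)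
firstDiff-∷ (ag , i∈A , i∉B) = agree-∷ ag , there i∈A , i∉B ∘ drop-there

compare-∷ : ∀ s → A ⊑ B ⊎ ∃ (FirstDiff B A) →
            (s ∷ A) ⊑ (s ∷ B) ⊎ ∃ (FirstDiff (s ∷ B) (s ∷ A))
compare-∷ s =
  Sum.map (Sum.map (cong (s ∷_)) (Prod.map suc firstDiff-∷)) (Prod.map suc firstDiff-∷)

compare : (A B : Subset n) → A ⊑ B ⊎ ∃ (FirstDiff B A)
compare [] [] = inj₁ (inj₁ refl)
compare (inside ∷ A) (inside ∷ B) = compare-∷ inside (compare A B)
compare (outside ∷ A) (outside ∷ B) = compare-∷ outside (compare A B)
compare (inside ∷ A) (outside ∷ B) = inj₁ (inj₂ (zero , (λ ()) , here , λ ()))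
compare (outside ∷ A) (inside ∷ B) = inj₂ (zero , (λ ()) , here , λ ())

≺⇒⊑ : A ≺ B → A ⊑ B
≺⇒⊑ {A = A} {B = B} A≺B with compare A B
... | inj₁ A⊑B = A⊑B
... | inj₂ (i , ag , i∈B , i∉A) with A≺B
...   | inj₁ B⊆A = ⊥-elim (i∉A (B⊆A i∈B))
...   | inj₂ (k , (k∈A , k∉B , _) , B∖A-above) =
  ⊥-elim (k∉B (from (ag (B∖A-above i i∈B i∉A)) k∈A))

⊑⇒≺ : A ⊑ B → A ≺ B
⊑⇒≺ (inj₁ refl) = inj₁ id
⊑⇒≺ {A = A} {B = B} (inj₂ (i , ag , i∈A , i∉B)) =
  inj₂ (i , (i∈A , i∉B , A∖B-above) , B∖A-above)
  where
  A∖B-above : ∀ j → j ∈ A → j ∉ B → i Fin.≤ j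
  A∖B-above j j∈A j∉B = ℕ.≮⇒≥ λ j<i → j∉B (to (ag j<i) j∈A)

  B∖A-above : ∀ j → j ∈ B → j ∉ A → i Fin.< j
  B∖A-above j j∈B j∉A with <-cmp i j
  ... | tri< i<j _ _ = i<j
  ... | tri≈ _ refl _ = ⊥-elim (i∉B j∈B)
  ... | tri> _ _ j<i = ⊥-elim (j∉A (from (ag j<i) j∈B))

⊑-trans : A ⊑ B → B ⊑ C → A ⊑ C
⊑-trans (inj₁ refl) B⊑C = B⊑C
⊑-trans A⊑B (inj₁ refl) = A⊑B
⊑-trans (inj₂ (i , agAB , i∈A , i∉B)) (inj₂ (j , agBC , j∈B , j∉C)) with <-cmp i j
... | tri< i<j _ _ =
  inj₂ (i , (λ k<i → ⇔.trans (agAB k<i) (agBC (ℕ.<-trans k<i i<j))) , i∈A , i∉B ∘ from (agBC i<j))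
... | tri≈ _ refl _ = ⊥-elim (i∉B j∈B)
... | tri> _ _ j<i =
  inj₂ (j , (λ k<j → ⇔.trans (agAB (ℕ.<-trans k<j j<i)) (agBC k<j)) , from (agAB j<i) j∈B , j∉C)

≺-trans : A ≺ B → B ≺ C → A ≺ C
≺-trans A≺B B≺C = ⊑⇒≺ (⊑-trans (≺⇒⊑ A≺B) (≺⇒⊑ B≺C))

⊑-split : (x : Fin n) → A ⊑ B →
          (∀ {j} → j Fin.≤ x → j ∈ B → j ∈ A) ⊎ ∃ λ i → i Fin.≤ x × FirstDiff A B i
⊑-split x (inj₁ refl) = inj₁ λ _ → id
⊑-split x (inj₂ (i , d@(ag , _))) with toℕ i ≤? toℕ x
... | yes i≤x = inj₂ (i , i≤x , d)
... | no i≰x = inj₁ λ j≤x → from (ag (ℕ.≤-<-trans j≤x (ℕ.≰⇒> i≰x)))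

⊑-initial⊂ : A ⊑ B → initial k ⊂ B → initial k ⊂ A
⊑-initial⊂ (inj₁ refl) k⊂B = k⊂B
⊑-initial⊂ {k = k} (inj₂ (i , ag , i∈A , i∉B)) (k⊆B , _) with toℕ i <? k
... | yes i<k = ⊥-elim (i∉B (k⊆B (∈initial⁺ i<k)))
... | no i≮k =
  (λ j∈k → from (ag (ℕ.<-≤-trans (∈initial⁻ j∈k) (ℕ.≮⇒≥ i≮k))) (k⊆B j∈k)) , i , i∈A , i≮k ∘ ∈initial⁻

𝓛-LInitial : (R : Subset n) → LInitial n k (𝓛 n R k)
𝓛-LInitial R = (λ _ → proj₁) , λ A B ∣A∣≡k A≺B (_ , B≺R) → ∣A∣≡k , ≺-trans A≺B B≺R


∣p∪q∣≤∣p∣+∣q∣ : (A B : Subset n) → ∣ A ∪ B ∣ ≤ ∣ A ∣ + ∣ B ∣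
∣p∪q∣≤∣p∣+∣q∣ [] [] = z≤n
∣p∪q∣≤∣p∣+∣q∣ (inside ∷ A) (s ∷ B) =
  s≤s (ℕ.≤-trans (∣p∪q∣≤∣p∣+∣q∣ A B) (ℕ.+-monoʳ-≤ ∣ A ∣ (∣p∣≤∣x∷p∣ s B)))
∣p∪q∣≤∣p∣+∣q∣ (outside ∷ A) (outside ∷ B) = ∣p∪q∣≤∣p∣+∣q∣ A B
∣p∪q∣≤∣p∣+∣q∣ (outside ∷ A) (inside ∷ B) =
  subst (suc ∣ A ∪ B ∣ ≤_) (sym (ℕ.+-suc ∣ A ∣ ∣ B ∣)) (s≤s (∣p∪q∣≤∣p∣+∣q∣ A B))

∃⊆-between : ∀ {n} {S U : Subset n} (a : ℕ) → S ⊆ U → ∣ S ∣ ≤ a → a ≤ ∣ U ∣ →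
             ∃ λ A → S ⊆ A × A ⊆ U × ∣ A ∣ ≡ a
∃⊆-between {S = []} {[]} zero _ _ _ = [] , id , id , refl
∃⊆-between {S = inside ∷ S} {outside ∷ U} a S⊆U _ _ with S⊆U here
... | ()
∃⊆-between {S = inside ∷ S} {inside ∷ U} (suc a) S⊆U (s≤s ∣S∣≤a) (s≤s a≤∣U∣)
  with ∃⊆-between a (drop-∷-⊆ S⊆U) ∣S∣≤a a≤∣U∣
... | A , S⊆A , A⊆U , ∣A∣≡a = inside ∷ A , in⊆in S⊆A , in⊆in A⊆U , cong suc ∣A∣≡a
∃⊆-between {S = outside ∷ S} {outside ∷ U} a S⊆U ∣S∣≤a a≤∣U∣
  with ∃⊆-between a (drop-∷-⊆ S⊆U) ∣S∣≤a a≤∣U∣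
... | A , S⊆A , A⊆U , ∣A∣≡a = outside ∷ A , s⊆s S⊆A , s⊆s A⊆U , ∣A∣≡a
∃⊆-between {S = outside ∷ S} {inside ∷ U} a S⊆U ∣S∣≤a _ with a ≤? ∣ U ∣
... | yes a≤∣U∣ with ∃⊆-between a (drop-∷-⊆ S⊆U) ∣S∣≤a a≤∣U∣
...   | A , S⊆A , A⊆U , ∣A∣≡a = outside ∷ A , s⊆s S⊆A , out⊆ A⊆U , ∣A∣≡a
∃⊆-between {S = outside ∷ S} {inside ∷ U} zero _ _ _ | no 0≰∣U∣ = ⊥-elim (0≰∣U∣ z≤n)
∃⊆-between {S = outside ∷ S} {inside ∷ U} (suc a) S⊆U _ (s≤s a≤∣U∣) | no 1+a≰∣U∣
  with ∃⊆-between a (drop-∷-⊆ S⊆U)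
         (ℕ.≤-trans (p⊆q⇒∣p∣≤∣q∣ (drop-∷-⊆ S⊆U)) (ℕ.≤-pred (ℕ.≰⇒> 1+a≰∣U∣))) a≤∣U∣
... | A , S⊆A , A⊆U , ∣A∣≡a = inside ∷ A , out⊆ S⊆A , in⊆in A⊆U , cong suc ∣A∣≡a

module Partners {n} {P Q : Subset n} {q : Fin n} (PQ : StronglyIntersectAt P Q q) where

  ∈P⇒≤q : j ∈ P → j Fin.≤ q
  ∈P⇒≤q {j = j} j∈P = ∈upTo⁻ (subst (j ∈_) (proj₂ PQ) (x∈p∪q⁺ (inj₁ j∈P)))

  ∈Q⇒≤q : j ∈ Q → j Fin.≤ q
  ∈Q⇒≤q {j = j} j∈Q = ∈upTo⁻ (subst (j ∈_) (proj₂ PQ) (x∈p∪q⁺ (inj₂ j∈Q)))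

  ≤q⇒∈P⊎∈Q : j Fin.≤ q → j ∈ P ⊎ j ∈ Q
  ≤q⇒∈P⊎∈Q {j = j} j≤q = x∈p∪q⁻ P Q (subst (j ∈_) (sym (proj₂ PQ)) (∈upTo⁺ j≤q))

  ∉P⇒∈Q : j Fin.≤ q → j ∉ P → j ∈ Q
  ∉P⇒∈Q j≤q j∉P = [ ⊥-elim ∘ j∉P , id ] (≤q⇒∈P⊎∈Q j≤q)

  ∉Q⇒∈P : j Fin.≤ q → j ∉ Q → j ∈ P
  ∉Q⇒∈P j≤q j∉Q = [ id , ⊥-elim ∘ j∉Q ] (≤q⇒∈P⊎∈Q j≤q)

  ∈P∩Q⇒≡q : j ∈ P → j ∈ Q → j ≡ q
  ∈P∩Q⇒≡q {j = j} j∈P j∈Q = x∈⁅y⁆⇒x≡y q (subst (j ∈_) (proj₁ PQ) (x∈p∩q⁺ (j∈P , j∈Q)))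

  ∈P∩Q⇒≮q : j ∈ P → j ∈ Q → ¬ j Fin.< q
  ∈P∩Q⇒≮q j∈P j∈Q = ℕ.<-irrefl (cong toℕ (∈P∩Q⇒≡q j∈P j∈Q))

  q∈P∩Q : q ∈ P ∩ Q
  q∈P∩Q = subst (q ∈_) (sym (proj₁ PQ)) (x∈⁅x⁆ q)

  q∈P : q ∈ P
  q∈P = proj₁ (x∈p∩q⁻ P Q q∈P∩Q)

  q∈Q : q ∈ Q
  q∈Q = proj₂ (x∈p∩q⁻ P Q q∈P∩Q)

  ⊑Q×⊑P⇒meet : A ⊑ Q → B ⊑ P → Nonempty (A ∩ B)
  ⊑Q×⊑P⇒meet A⊑Q B⊑P with ⊑-split q A⊑Q | ⊑-split q B⊑P
  ... | inj₁ Q⊆A | inj₁ P⊆B = q , x∈p∩q⁺ (Q⊆A ℕ.≤-refl q∈Q , P⊆B ℕ.≤-refl q∈P)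
  ... | inj₁ Q⊆A | inj₂ (j , j≤q , _ , j∈B , j∉P) = j , x∈p∩q⁺ (Q⊆A j≤q (∉P⇒∈Q j≤q j∉P) , j∈B)
  ... | inj₂ (i , i≤q , _ , i∈A , i∉Q) | inj₁ P⊆B = i , x∈p∩q⁺ (i∈A , P⊆B i≤q (∉Q⇒∈P i≤q i∉Q))
  ... | inj₂ (i , i≤q , agA , i∈A , i∉Q) | inj₂ (j , j≤q , agB , j∈B , j∉P) with <-cmp i j
  ...   | tri< i<j _ _ = i , x∈p∩q⁺ (i∈A , from (agB i<j) (∉Q⇒∈P i≤q i∉Q))
  ...   | tri≈ _ refl _ = ⊥-elim (j∉P (∉Q⇒∈P i≤q i∉Q))
  ...   | tri> _ _ j<i = j , x∈p∩q⁺ (from (agA j<i) (∉P⇒∈Q j≤q j∉P) , j∈B)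

  module _ {a b : ℕ} {G : Subset n}
           (a+b≤n : a + b ≤ n) (∣P∣≤a : ∣ P ∣ ≤ a) (∣G∣≡b : ∣ G ∣ ≡ b) where

    FirstDiff-Q⇒𝓛P-avoids : ∀ {i} → FirstDiff Q G i → ∃ λ A → 𝓛 n P a A × A ⊆ ∁ G
    FirstDiff-Q⇒𝓛P-avoids {i} (ag , i∈Q , i∉G) =
      let A , S⊆A , A⊆∁G , ∣A∣≡a = ∃⊆-between a S⊆∁G ∣S∣≤a a≤∣∁G∣
      in A , (∣A∣≡a , A≺P S⊆A A⊆∁G) , A⊆∁G
      where
      i≤q : i Fin.≤ q
      i≤q = ∈Q⇒≤q i∈Q

      X S : Subset n
      X = P ∩ initial (toℕ i)
      S = ⁅ i ⁆ ∪ X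

      ∈S⁺ : ∀ {x} → x ≡ i ⊎ x ∈ P × x Fin.< i → x ∈ S
      ∈S⁺ (inj₁ refl) = x∈p∪q⁺ (inj₁ (x∈⁅x⁆ i))
      ∈S⁺ (inj₂ (x∈P , x<i)) = x∈p∪q⁺ (inj₂ (x∈p∩q⁺ (x∈P , ∈initial⁺ x<i)))

      ∈S⁻ : ∀ {x} → x ∈ S → x ≡ i ⊎ x ∈ P × x Fin.< i
      ∈S⁻ x∈S with x∈p∪q⁻ ⁅ i ⁆ _ x∈S
      ... | inj₁ x∈⁅i⁆ = inj₁ (x∈⁅y⁆⇒x≡y i x∈⁅i⁆)
      ... | inj₂ x∈X = inj₂ (Prod.map₂ ∈initial⁻ (x∈p∩q⁻ P _ x∈X))

      S⊆∁G : S ⊆ ∁ G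
      S⊆∁G x∈S with ∈S⁻ x∈S
      ... | inj₁ refl = x∉p⇒x∈∁p i∉G
      ... | inj₂ (x∈P , x<i) = x∉p⇒x∈∁p λ x∈G →
        ∈P∩Q⇒≮q x∈P (from (ag x<i) x∈G) (ℕ.<-≤-trans x<i i≤q)

      ∣S∣≤a : ∣ S ∣ ≤ a
      ∣S∣≤a with i ∈? P
      ... | yes i∈P = ℕ.≤-trans (p⊆q⇒∣p∣≤∣q∣ S⊆P) ∣P∣≤a
        where
        S⊆P : S ⊆ P
        S⊆P x∈S = [ (λ { refl → i∈P }) , proj₁ ] (∈S⁻ x∈S)
      ... | no i∉P = ℕ.≤-trans (∣p∪q∣≤∣p∣+∣q∣ ⁅ i ⁆ X)
                      (subst (λ c → c + ∣ X ∣ ≤ a) (sym (∣⁅x⁆∣≡1 i))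
                        (ℕ.≤-trans (p⊂q⇒∣p∣<∣q∣ X⊂P) ∣P∣≤a))
        where
        X⊂P : X ⊂ P
        X⊂P = p∩q⊆p P _ , q , q∈P , λ q∈X → ℕ.<⇒≱ (∈initial⁻ (proj₂ (x∈p∩q⁻ P _ q∈X))) i≤q

      a≤∣∁G∣ : a ≤ ∣ ∁ G ∣
      a≤∣∁G∣ = subst (a ≤_) (sym (trans (∣∁p∣≡n∸∣p∣ G) (cong (n ∸_) ∣G∣≡b)))
                 (ℕ.m+n≤o⇒m≤o∸n a a+b≤n)

      A≺P : ∀ {A} → S ⊆ A → A ⊆ ∁ G → A ≺ P
      A≺P {A} S⊆A A⊆∁G with i ∈? P
      ... | yes i∈P = inj₁ (S⊆A ∘ P⊆S)
        where
        P⊆S : P ⊆ S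
        P⊆S {x} x∈P with <-cmp x i
        ... | tri< x<i _ _ = ∈S⁺ (inj₂ (x∈P , x<i))
        ... | tri≈ _ x≡i _ = ∈S⁺ (inj₁ x≡i)
        ... | tri> _ _ i<x =
          ⊥-elim (ℕ.<⇒≱ i<x (subst (x Fin.≤_) (sym (∈P∩Q⇒≡q i∈P i∈Q)) (∈P⇒≤q x∈P)))
      ... | no i∉P = ⊑⇒≺ (inj₂ (i , agree , S⊆A (∈S⁺ (inj₁ refl)) , i∉P))
        where
        agree : Agree A P i
        agree {j} j<i = mk⇔
          (λ j∈A → ∉Q⇒∈P (ℕ.<⇒≤ (ℕ.<-≤-trans j<i i≤q)) λ j∈Q →
             x∈∁p⇒x∉p (A⊆∁G j∈A) (to (ag j<i) j∈Q))
          (λ j∈P → S⊆A (∈S⁺ (inj₂ (j∈P , j<i))))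

    ⊑Q-maximal : (∀ A → 𝓛 n P a A → Nonempty (G ∩ A)) → G ⊑ Q
    ⊑Q-maximal meets with compare G Q
    ... | inj₁ G⊑Q = G⊑Q
    ... | inj₂ (_ , d) with FirstDiff-Q⇒𝓛P-avoids d
    ...   | A , A∈𝓛 , A⊆∁G with meets A A∈𝓛
    ...     | x , x∈G∩A =
      let x∈G , x∈A = x∈p∩q⁻ G A x∈G∩A in ⊥-elim (x∈∁p⇒x∉p (A⊆∁G x∈A) x∈G)

  module _ {b : ℕ} (b≤n : b ≤ n) {m : Fin n} (m-min : IsMin P m) where

    initial-min⊂Q : initial (toℕ m) ⊂ Q
    initial-min⊂Q = initial⊆Q , q , q∈Q , λ q∈init → ℕ.<⇒≱ (∈initial⁻ q∈init) m≤q
      where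
      m≤q : m Fin.≤ q
      m≤q = ∈P⇒≤q (proj₁ m-min)

      initial⊆Q : initial (toℕ m) ⊆ Q
      initial⊆Q {j} j∈init =
        ∉P⇒∈Q (ℕ.<⇒≤ (ℕ.<-≤-trans j<m m≤q)) λ j∈P → ℕ.<⇒≱ j<m (proj₂ m-min j j∈P)
        where
        j<m : j Fin.< m
        j<m = ∈initial⁻ j∈init

    initial⊑Q : toℕ m < b → initial b ⊑ Q
    initial⊑Q m<b with compare (initial b) Q
    ... | inj₁ b⊑Q = b⊑Q
    ... | inj₂ (i , ag , i∈Q , i∉b) =
      ⊥-elim (∈P∩Q⇒≮q (proj₁ m-min) m∈Q (ℕ.<-≤-trans m<i (∈Q⇒≤q i∈Q)))
      where
      m<i : m Fin.< i
      m<i = ℕ.<-≤-trans m<b (ℕ.≮⇒≥ (i∉b ∘ ∈initial⁺))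
      m∈Q : m ∈ Q
      m∈Q = from (ag m<i) (∈initial⁺ m<b)

    𝓛Q-nonempty⇔min<b : (∃ λ F → 𝓛 n Q b F) ⇔ suc (toℕ m) ≤ b
    𝓛Q-nonempty⇔min<b = mk⇔
      (λ (F , ∣F∣≡b , F≺Q) →
        subst₂ _<_ (∣initial∣ (ℕ.<⇒≤ (toℕ<n m))) ∣F∣≡b
          (p⊂q⇒∣p∣<∣q∣ (⊑-initial⊂ (≺⇒⊑ F≺Q) initial-min⊂Q)))
      (λ m<b → initial b , ∣initial∣ b≤n , ⊑⇒≺ (initial⊑Q m<b))

proposition3 : (n a b : ℕ) → 1 ≤ a → 1 ≤ b → 1 ≤ n → a + b ≤ n →
    (P Q : Subset n) → Nonempty P → ∣ P ∣ ≤ a → Partner P Q →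
    ( LInitial n b (𝓛 n Q b)
      × CrossIntersecting (𝓛 n Q b) (𝓛 n P a)
      × (∀ (𝓖 : Family n) → LInitial n b 𝓖 → CrossIntersecting 𝓖 (𝓛 n P a) →
           ∀ G → 𝓖 G → 𝓛 n Q b G) )
    × (∀ (m : Fin n) → IsMin P m → ((∃ λ F → 𝓛 n Q b F) ⇔ (suc (toℕ m) ≤ b)))
-- Nonempty P is implied by the partner relation (q ∈ P).
proposition3 n a b _ _ _ a+b≤n P Q _ ∣P∣≤a (q , PQ) =
  ( 𝓛-LInitial Q
  , (λ F G (_ , F≺Q) (_ , G≺P) → ⊑Q×⊑P⇒meet (≺⇒⊑ F≺Q) (≺⇒⊑ G≺P))
  , (λ 𝓖 (𝓖-uniform , _) cross G G∈𝓖 →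
       let ∣G∣≡b = 𝓖-uniform G G∈𝓖
       in ∣G∣≡b , ⊑⇒≺ (⊑Q-maximal a+b≤n ∣P∣≤a ∣G∣≡b λ A → cross G A G∈𝓖) ) )
  , λ m m-min → 𝓛Q-nonempty⇔min<b (ℕ.m+n≤o⇒n≤o a a+b≤n) m-min
  where open Partners PQ
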